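{- For every $n\ge 1$ there is a polynomial $P_n(k)\in\mathbb{Q}[k]$ of degree $n-1$ such that for all integers $k\ge 2$, $A^{\mathbf r}_{n,k}=\frac{1}{n!}\,k\,P_n(k)$, and the coefficient of $k^1$ in $kP_n(k)$ (i.e. $P_n(0)$) equals $(-1)^{n-1}(n-1)!$.
   Context: For $k\ge 2$, $C_k\wr S_n$ is identified with the set of pairs $(\sigma,w)$, $\sigma\in S_n$, $w=w_1\cdots w_n\in\{0,\dots,k-1\}^n$. $A^{\mathbf r}_{n,k}$ is the number of $(\sigma,w)\in C_k\wr S_n$ for which there is no $i\in\{1,\dots,n-1\}$ with $\sigma_i<\sigma_{i+1}$ and $w_i\le w_{i+1}$. -}

module Defs where

open import Data.Bool using (Bool; true; false; _∧_; not)
open import Data.Nat as ℕ using (ℕ; zero; suc; _!)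
open import Data.Fin as Fin using (Fin)
open import Data.Fin.Properties using (_≟_)
open import Data.Vec using (Vec; []; _∷_; toList)
open import Data.List as List using (List; []; _∷_; map; concatMap; filter; length; allFin)
open import Data.Integer using (ℤ; +_)
open import Data.Rational using (ℚ; _/_; _+_; _*_; 0ℚ)
open import Relation.Nullary.Decidable using (⌊_⌋)
open import Data.Product using (_×_; _,_; proj₁; proj₂)

allWords : (m n : ℕ) → List (Vec (Fin m) n)
allWords m zero = [] ∷ []
allWords m (suc n) = concatMap (λ a → map (a ∷_) (allWords m n)) (allFin m)

notIn : ∀ {m} → Fin m → List (Fin m) → Bool
notIn a [] = true
notIn a (b ∷ bs) = not ⌊ a ≟ b ⌋ ∧ notIn a bs

distinct : ∀ {m} → List (Fin m) → Bool
distinct [] = true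
distinct (a ∷ as) = notIn a as ∧ distinct as

-- S_n in one-line notation σ = σ₁ ⋯ σₙ: the injective words of length n over Fin n.
perms : (n : ℕ) → List (Vec (Fin n) n)
perms n = filter (λ σ → distinct (toList σ) Data.Bool.≟ true) (allWords n n)

noBadAscent : ∀ {n k l} → Vec (Fin n) l → Vec (Fin k) l → Bool
noBadAscent (s ∷ s' ∷ ss) (w ∷ w' ∷ ws) =
  not (⌊ s Fin.<? s' ⌋ ∧ ⌊ w Fin.≤? w' ⌋) ∧ noBadAscent (s' ∷ ss) (w' ∷ ws)
noBadAscent _ _ = true

-- C_k ≀ S_n as pairs (σ , w), σ ∈ S_n, w ∈ {0,…,k-1}ⁿ.
wreath : (n k : ℕ) → List (Vec (Fin n) n × Vec (Fin k) n)
wreath n k = concatMap (λ σ → map (σ ,_) (allWords k n)) (perms n)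

Ar : (n k : ℕ) → ℕ
Ar n k = length (filter (λ p → noBadAscent (proj₁ p) (proj₂ p) Data.Bool.≟ true) (wreath n k))

ℕ→ℚ : ℕ → ℚ
ℕ→ℚ a = + a / 1

-- Polynomial given by its coefficient vector c₀ c₁ … (c₀ constant term), evaluated at x.
evalPoly : ∀ {d} → Vec ℚ d → ℚ → ℚ
evalPoly [] x = 0ℚ
evalPoly (c ∷ cs) x = c + x * evalPoly cs x

module Submission where

-- Group the pairs (σ , w) by σ.  For fixed σ the condition only asks w to descend strictly at the
-- ascents of σ; these cut the positions 1 … n into blocks on which w is strictly decreasing, with no
-- constraint between blocks, so there are ∏ C(k, L) such words, L running over the block lengths.
-- Multiplied by n! this is (n! / ∏ L!) · ∏ k (k-1) ⋯ (k-L+1): a multinomial coefficient times a monic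
-- polynomial of degree n divisible by k, whose coefficient of k vanishes unless there is only one block.
-- Summing over σ, the leading coefficient of P_n is Σ_σ n! / ∏ L! > 0, and P_n(0) comes from the identity
-- permutation alone, the only one with a single block: the coefficient of k in k (k-1) ⋯ (k-n+1).

open import Defs

module Counting where

  open import Data.Bool using (Bool; true; false; _∧_; not; if_then_else_; T)
  open import Data.Bool.Properties using (T-≡; T-∧)
  open import Function.Bundles using (Equivalence)
  open import Relation.Nullary using (yes; no)
  import Data.Bool as Bool
  open import Data.Nat as ℕ using (ℕ; zero; suc; _+_; _*_; _∸_; _≤_; _<ᵇ_; _≤ᵇ_; z≤n; s≤s)
  import Data.Nat.Properties as ℕP
  open import Data.Nat.Combinatorics using (_C_; nCk+nC[k+1]≡[n+1]C[k+1]; nC1≡n; nCn≡1)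
  open import Data.Nat.ListAction using (sum)
  open import Data.Fin as Fin using (Fin; toℕ; inject₁; fromℕ)
  import Data.Fin.Properties as FinP
  open import Data.List as List using (List; []; _∷_; map; concatMap; filter; length; allFin; tabulate; _++_)
  import Data.List.Properties as ListP
  open import Data.Vec as Vec using (Vec; []; _∷_; toList; replicate)
  open import Algebra.Properties.Semiring.Sum ℕP.+-*-semiring
    using (sum-syntax; sum-cong-≗; sum-init-last; *-distribʳ-sum)
  open import Data.Product using (_×_; _,_)
  open import Function using (_∘_; id)
  open import Relation.Binary.PropositionalEquality
  open import Relation.Nullary.Decidable using (⌊_⌋; isYes≗does)

  private
    variable
      A B : Set
      j k n : ℕ

  count : (A → Bool) → List A → ℕ
  count p []       = 0
  count p (x ∷ xs) = if p x then suc (count p xs) else count p xs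

  length-filter≡count : ∀ (p : A → Bool) xs → length (filter (λ x → p x Bool.≟ true) xs) ≡ count p xs
  length-filter≡count p []       = refl
  length-filter≡count p (x ∷ xs) with p x
  ... | true  = cong suc (length-filter≡count p xs)
  ... | false = length-filter≡count p xs

  count-++ : ∀ (p : A → Bool) xs ys → count p (xs ++ ys) ≡ count p xs + count p ys
  count-++ p []       ys = refl
  count-++ p (x ∷ xs) ys with p x
  ... | true  = cong suc (count-++ p xs ys)
  ... | false = count-++ p xs ys

  count-concatMap : ∀ (p : B → Bool) (f : A → List B) xs →
                    count p (concatMap f xs) ≡ sum (map (count p ∘ f) xs)
  count-concatMap p f []       = refl
  count-concatMap p f (x ∷ xs) =
    trans (count-++ p (f x) (concatMap f xs)) (cong (count p (f x) +_) (count-concatMap p f xs))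

  count-map : ∀ (p : B → Bool) (f : A → B) xs → count p (map f xs) ≡ count (p ∘ f) xs
  count-map p f []       = refl
  count-map p f (x ∷ xs) with p (f x)
  ... | true  = cong suc (count-map p f xs)
  ... | false = count-map p f xs

  count-cong : ∀ {p q : A → Bool} → (∀ x → p x ≡ q x) → ∀ xs → count p xs ≡ count q xs
  count-cong p≗q []       = refl
  count-cong {q = q} p≗q (x ∷ xs) rewrite p≗q x with q x
  ... | true  = cong suc (count-cong p≗q xs)
  ... | false = count-cong p≗q xs

  count-∧ˡ : ∀ b (p : A → Bool) xs → count (λ x → b ∧ p x) xs ≡ (if b then count p xs else 0)
  count-∧ˡ true  p xs       = refl
  count-∧ˡ false p []       = refl
  count-∧ˡ false p (x ∷ xs) = count-∧ˡ false p xs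

  count-filter : ∀ (p q : A → Bool) → (∀ x → T (p x) → T (q x)) → ∀ xs →
                 count p (filter (λ x → q x Bool.≟ true) xs) ≡ count p xs
  count-filter p q p⇒q []       = refl
  count-filter p q p⇒q (x ∷ xs) with q x in qx
  ... | true  with p x
  ...   | true  = cong suc (count-filter p q p⇒q xs)
  ...   | false = count-filter p q p⇒q xs
  count-filter p q p⇒q (x ∷ xs) | false with p x in px
  ...   | true  with () ← subst T qx (p⇒q x (Equivalence.from T-≡ px))
  ...   | false = count-filter p q p⇒q xs

  count≤sum : ∀ (p : A → Bool) (f : A → ℕ) → (∀ x → p x ≡ true → 1 ≤ f x) → ∀ xs →
              count p xs ≤ sum (map f xs)
  count≤sum p f p⇒1≤f []       = z≤n
  count≤sum p f p⇒1≤f (x ∷ xs) with p x in px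
  ... | true  = ℕP.+-mono-≤ (p⇒1≤f x px) (count≤sum p f p⇒1≤f xs)
  ... | false = ℕP.≤-trans (count≤sum p f p⇒1≤f xs) (ℕP.m≤n+m _ (f x))

  sum-map-*ˡ : ∀ (f : A → ℕ) c xs → sum (map (λ x → c * f x) xs) ≡ c * sum (map f xs)
  sum-map-*ˡ f c []       = sym (ℕP.*-zeroʳ c)
  sum-map-*ˡ f c (x ∷ xs) =
    trans (cong (c * f x +_) (sum-map-*ˡ f c xs)) (sym (ℕP.*-distribˡ-+ c (f x) (sum (map f xs))))

  sum-map-allFin : ∀ k (f : Fin k → ℕ) → sum (map f (allFin k)) ≡ ∑[ a < k ] f a
  sum-map-allFin k f = trans (cong sum (ListP.map-tabulate id f)) (sum-tabulate k f)
    where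
    sum-tabulate : ∀ k (f : Fin k → ℕ) → sum (tabulate f) ≡ ∑[ a < k ] f a
    sum-tabulate zero    f = refl
    sum-tabulate (suc k) f = cong (f Fin.zero +_) (sum-tabulate k (f ∘ Fin.suc))

  ∑-below : ∀ {k} x (g : ℕ → ℕ) → x ≤ k →
            ∑[ y < k ] (if toℕ y <ᵇ x then g (toℕ y) else 0) ≡ ∑[ y < x ] g (toℕ y)
  ∑-below {zero}  zero    g z≤n       = refl
  ∑-below {suc k} zero    g z≤n       = ∑-below {k} zero (g ∘ suc) z≤n
  ∑-below {suc k} (suc x) g (s≤s x≤k) = cong (g 0 +_) (∑-below x (g ∘ suc) x≤k)

  hockey-stick : ∀ x r → ∑[ y < x ] (toℕ y C r) ≡ x C suc r
  hockey-stick zero    r = refl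
  hockey-stick (suc x) r = begin
    ∑[ y < suc x ] (toℕ y C r)
      ≡⟨ sum-init-last (λ y → toℕ y C r) ⟩
    ∑[ y < x ] (toℕ (inject₁ y) C r) + toℕ (fromℕ x) C r
      ≡⟨ cong₂ _+_ (sum-cong-≗ {x} (λ y → cong (_C r) (FinP.toℕ-inject₁ y))) (cong (_C r) (FinP.toℕ-fromℕ x)) ⟩
    ∑[ y < x ] (toℕ y C r) + x C r
      ≡⟨ cong (_+ x C r) (hockey-stick x r) ⟩
    x C suc r + x C r
      ≡⟨ ℕP.+-comm (x C suc r) (x C r) ⟩
    x C r + x C suc r
      ≡⟨ nCk+nC[k+1]≡[n+1]C[k+1] x r ⟩
    suc x C suc r ∎
    where open ≡-Reasoning

  hockey-stick-reversed : ∀ k r → ∑[ y < k ] ((k ∸ suc (toℕ y)) C r) ≡ k C suc r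
  hockey-stick-reversed zero    r = refl
  hockey-stick-reversed (suc k) r =
    trans (cong (k C r +_) (hockey-stick-reversed k r)) (nCk+nC[k+1]≡[n+1]C[k+1] k r)

  hockey-stick-reversed-above : ∀ k x r → ∑[ y < k ] (if x <ᵇ toℕ y then (k ∸ suc (toℕ y)) C r else 0) ≡ (k ∸ suc x) C suc r
  hockey-stick-reversed-above zero    x       r = refl
  hockey-stick-reversed-above (suc k) zero    r = hockey-stick-reversed k r
  hockey-stick-reversed-above (suc k) (suc x) r = hockey-stick-reversed-above k x r

  absorption : ∀ n s → suc s * (suc n C suc s) ≡ suc n * (n C s)
  absorption zero    zero    = refl
  absorption zero    (suc s) = ℕP.*-zeroʳ (2 + s)
  absorption (suc n) zero    = trans (ℕP.*-identityˡ _) (trans (nC1≡n (2 + n)) (sym (ℕP.*-identityʳ (2 + n))))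
  absorption (suc n) (suc s) = begin
    (2 + s) * ((2 + n) C (2 + s))                 ≡⟨ cong ((2 + s) *_) (nCk+nC[k+1]≡[n+1]C[k+1] (suc n) (suc s)) ⟨
    (2 + s) * (a + b)                             ≡⟨ expand s a b ⟩
    (1 + s) * a + a + (2 + s) * b                 ≡⟨ cong₂ (λ u v → u + a + v) (absorption n s) (absorption n (suc s)) ⟩
    (1 + n) * (n C s) + a + (1 + n) * (n C suc s) ≡⟨ collect n a (n C s) (n C suc s) ⟩
    (1 + n) * (n C s + n C suc s) + a             ≡⟨ cong (λ u → (1 + n) * u + a) (nCk+nC[k+1]≡[n+1]C[k+1] n s) ⟩
    (1 + n) * a + a                               ≡⟨ ℕP.+-comm ((1 + n) * a) a ⟩
    (2 + n) * a                                   ∎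
    where
    open ≡-Reasoning
    open import Data.Nat.Tactic.RingSolver using (solve-∀)
    a = suc n C suc s
    b = suc n C (2 + s)
    expand : ∀ s a b → (2 + s) * (a + b) ≡ (1 + s) * a + a + (2 + s) * b
    expand = solve-∀
    collect : ∀ n a c d → (1 + n) * c + a + (1 + n) * d ≡ (1 + n) * (c + d) + a
    collect = solve-∀

  binomial-recurrence : ∀ k s → suc s * (k C suc s) + s * (k C s) ≡ k * (k C s)
  binomial-recurrence zero    zero    = refl
  binomial-recurrence zero    (suc s) = cong₂ _+_ (ℕP.*-zeroʳ (2 + s)) (ℕP.*-zeroʳ (1 + s))
  binomial-recurrence (suc k) zero    = trans (ℕP.+-identityʳ _) (trans (ℕP.*-identityˡ _) (trans (nC1≡n (suc k)) (sym (ℕP.*-identityʳ (suc k)))))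
  binomial-recurrence (suc k) (suc s) = begin
    (2 + s) * (suc k C (2 + s)) + (1 + s) * (suc k C suc s) ≡⟨ cong₂ _+_ (absorption k (suc s)) (absorption k s) ⟩
    (1 + k) * (k C suc s) + (1 + k) * (k C s)             ≡⟨ sym (ℕP.*-distribˡ-+ (1 + k) (k C suc s) (k C s)) ⟩
    (1 + k) * (k C suc s + k C s)                         ≡⟨ cong ((1 + k) *_) (ℕP.+-comm (k C suc s) (k C s)) ⟩
    (1 + k) * (k C s + k C suc s)                         ≡⟨ cong ((1 + k) *_) (nCk+nC[k+1]≡[n+1]C[k+1] k s) ⟩
    (1 + k) * (suc k C suc s)                             ∎
    where open ≡-Reasoning

  leadingTrues : Vec Bool j → ℕ
  leadingTrues []           = 0
  leadingTrues (true ∷ bs)  = suc (leadingTrues bs)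
  leadingTrues (false ∷ bs) = 0

  -- A vector bs : Vec Bool j joins (true) or separates (false) consecutive positions of a word
  -- of length j + 1, cutting it into blocks.  blockProduct c bs is the product of c m L over the
  -- blocks, where L is the length of the block and m the number of positions from its start on.
  mutual
    blockProduct : (ℕ → ℕ → ℕ) → Vec Bool j → ℕ
    blockProduct {j} c bs = c (suc j) (suc (leadingTrues bs)) * afterFirstBlock c bs

    afterFirstBlock : (ℕ → ℕ → ℕ) → Vec Bool j → ℕ
    afterFirstBlock c []           = 1
    afterFirstBlock c (true ∷ bs)  = afterFirstBlock c bs
    afterFirstBlock c (false ∷ bs) = blockProduct c bs

  descentCount : ℕ → Vec Bool j → ℕ
  descentCount k = blockProduct (λ _ L → k C L)

  multinomial : Vec Bool j → ℕ
  multinomial = blockProduct _C_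

  allTrue : Vec Bool j → Bool
  allTrue []       = true
  allTrue (b ∷ bs) = b ∧ allTrue bs

  descentCount-false : ∀ k (bs : Vec Bool j) → descentCount k (false ∷ bs) ≡ k * descentCount k bs
  descentCount-false k bs = cong (_* descentCount k bs) (nC1≡n k)

  descentCount-true : ∀ k (bs : Vec Bool j) → let s = suc (leadingTrues bs) in
                      suc s * descentCount k (true ∷ bs) + s * descentCount k bs ≡ k * descentCount k bs
  descentCount-true k bs = begin
    suc s * ((k C suc s) * rest) + s * ((k C s) * rest) ≡⟨ factor (suc s) (k C suc s) s (k C s) rest ⟩
    (suc s * (k C suc s) + s * (k C s)) * rest          ≡⟨ cong (_* rest) (binomial-recurrence k s) ⟩
    k * (k C s) * rest                                  ≡⟨ ℕP.*-assoc k (k C s) rest ⟩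
    k * ((k C s) * rest)                                ∎
    where
    open ≡-Reasoning
    open import Data.Nat.Tactic.RingSolver using (solve-∀)
    s = suc (leadingTrues bs)
    rest = afterFirstBlock (λ _ L → k C L) bs
    factor : ∀ a x b y r → a * (x * r) + b * (y * r) ≡ (a * x + b * y) * r
    factor = solve-∀

  multinomial-false : ∀ (bs : Vec Bool j) → multinomial (false ∷ bs) ≡ (2 + j) * multinomial bs
  multinomial-false {j} bs = cong (_* multinomial bs) (nC1≡n (2 + j))

  multinomial-true : ∀ (bs : Vec Bool j) → suc (suc (leadingTrues bs)) * multinomial (true ∷ bs) ≡ (2 + j) * multinomial bs
  multinomial-true {j} bs = begin
    suc s * (((2 + j) C suc s) * rest) ≡⟨ ℕP.*-assoc (suc s) ((2 + j) C suc s) rest ⟨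
    suc s * ((2 + j) C suc s) * rest   ≡⟨ cong (_* rest) (absorption (suc j) s) ⟩
    (2 + j) * (suc j C s) * rest       ≡⟨ ℕP.*-assoc (2 + j) (suc j C s) rest ⟩
    (2 + j) * ((suc j C s) * rest)     ∎
    where
    open ≡-Reasoning
    s = suc (leadingTrues bs)
    rest = afterFirstBlock _C_ bs

  leadingTrues-allTrue : ∀ (bs : Vec Bool j) → allTrue bs ≡ true → leadingTrues bs ≡ j
  leadingTrues-allTrue []          _  = refl
  leadingTrues-allTrue (true ∷ bs) eq = cong suc (leadingTrues-allTrue bs eq)

  multinomial-allTrue : ∀ (bs : Vec Bool j) → allTrue bs ≡ true → multinomial bs ≡ 1
  multinomial-allTrue {j} bs eq = begin
    (suc j C suc (leadingTrues bs)) * afterFirstBlock _C_ bs ≡⟨ cong₂ (λ l r → (suc j C suc l) * r) (leadingTrues-allTrue bs eq) (afterFirstBlock-allTrue bs eq) ⟩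
    (suc j C suc j) * 1                                      ≡⟨ cong (_* 1) (nCn≡1 (suc j)) ⟩
    1                                                        ∎
    where
    open ≡-Reasoning
    afterFirstBlock-allTrue : ∀ {i} (bs : Vec Bool i) → allTrue bs ≡ true → afterFirstBlock _C_ bs ≡ 1
    afterFirstBlock-allTrue []          _  = refl
    afterFirstBlock-allTrue (true ∷ bs) eq = afterFirstBlock-allTrue bs eq

  relatedAt : (Fin k → Fin k → Bool) → Vec Bool j → Vec (Fin k) (suc j) → Bool
  relatedAt R []       (a ∷ [])     = true
  relatedAt R (b ∷ bs) (a ∷ a' ∷ w) = (if b then R a a' else true) ∧ relatedAt R bs (a' ∷ w)

  countFrom : (Fin k → Fin k → Bool) → Vec Bool j → Fin k → ℕ
  countFrom {k} {j} R bs a = count (λ w → relatedAt R bs (a ∷ w)) (allWords k j)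

  count-allWords-suc : ∀ (p : Vec (Fin k) (suc j) → Bool) →
                       count p (allWords k (suc j)) ≡ ∑[ a < k ] count (p ∘ (a ∷_)) (allWords k j)
  count-allWords-suc {k} {j} p = begin
    count p (concatMap (λ a → map (a ∷_) (allWords k j)) (allFin k))
      ≡⟨ count-concatMap p (λ a → map (a ∷_) (allWords k j)) (allFin k) ⟩
    sum (map (λ a → count p (map (a ∷_) (allWords k j))) (allFin k))
      ≡⟨ cong sum (ListP.map-cong (λ a → count-map p (a ∷_) (allWords k j)) (allFin k)) ⟩
    sum (map (λ a → count (p ∘ (a ∷_)) (allWords k j)) (allFin k))
      ≡⟨ sum-map-allFin k _ ⟩
    ∑[ a < k ] count (p ∘ (a ∷_)) (allWords k j) ∎
    where open ≡-Reasoning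

  countFrom-∷ : ∀ R b (bs : Vec Bool j) (a : Fin k) →
                countFrom R (b ∷ bs) a ≡ ∑[ a' < k ] (if (if b then R a a' else true) then countFrom R bs a' else 0)
  countFrom-∷ {j} {k} R b bs a = trans (count-allWords-suc {k} {j} _)
    (sum-cong-≗ {k} (λ a' → count-∧ˡ (if b then R a a' else true) (λ w → relatedAt R bs (a' ∷ w)) (allWords k j)))

  descends : Fin k → Fin k → Bool
  descends a a' = toℕ a' <ᵇ toℕ a

  mutual
    countFrom-descends : ∀ (bs : Vec Bool j) (a : Fin k) →
                         countFrom descends bs a ≡ (toℕ a C leadingTrues bs) * afterFirstBlock (λ _ L → k C L) bs
    countFrom-descends []           a = refl
    countFrom-descends {k = k} (false ∷ bs) a = begin
      countFrom descends (false ∷ bs) a             ≡⟨ countFrom-∷ descends false bs a ⟩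
      ∑[ a' < k ] countFrom descends bs a'          ≡⟨ count-allWords-suc {k} (relatedAt descends bs) ⟨
      count (relatedAt descends bs) (allWords k _)  ≡⟨ count-descends k bs ⟩
      descentCount k bs                             ≡⟨ ℕP.*-identityˡ _ ⟨
      (toℕ a C 0) * descentCount k bs               ∎
      where open ≡-Reasoning
    countFrom-descends {k = k} (true ∷ bs) a = begin
      countFrom descends (true ∷ bs) a
        ≡⟨ countFrom-∷ descends true bs a ⟩
      ∑[ a' < k ] (if descends a a' then countFrom descends bs a' else 0)
        ≡⟨ sum-cong-≗ {k} (λ a' → cong (if descends a a' then_else 0) (countFrom-descends bs a')) ⟩
      ∑[ a' < k ] (if toℕ a' <ᵇ toℕ a then (toℕ a' C l) * rest else 0)
        ≡⟨ ∑-below (toℕ a) (λ y → (y C l) * rest) (ℕP.<⇒≤ (FinP.toℕ<n a)) ⟩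
      ∑[ y < toℕ a ] ((toℕ y C l) * rest)
        ≡⟨ *-distribʳ-sum {toℕ a} rest (λ y → toℕ y C l) ⟨
      ∑[ y < toℕ a ] (toℕ y C l) * rest
        ≡⟨ cong (_* rest) (hockey-stick (toℕ a) l) ⟩
      (toℕ a C suc l) * rest ∎
      where
      open ≡-Reasoning
      l = leadingTrues bs
      rest = afterFirstBlock (λ _ L → k C L) bs

    count-descends : ∀ k (bs : Vec Bool j) → count (relatedAt descends bs) (allWords k (suc j)) ≡ descentCount k bs
    count-descends {j} k bs = begin
      count (relatedAt descends bs) (allWords k _) ≡⟨ count-allWords-suc {k} {j} (relatedAt descends bs) ⟩
      ∑[ a < k ] countFrom descends bs a           ≡⟨ sum-cong-≗ {k} (countFrom-descends bs) ⟩
      ∑[ a < k ] ((toℕ a C l) * rest)              ≡⟨ *-distribʳ-sum {k} rest (λ a → toℕ a C l) ⟨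
      ∑[ a < k ] (toℕ a C l) * rest                ≡⟨ cong (_* rest) (hockey-stick k l) ⟩
      (k C suc l) * rest                           ∎
      where
      open ≡-Reasoning
      l = leadingTrues bs
      rest = afterFirstBlock (λ _ L → k C L) bs

  ascends : Fin k → Fin k → Bool
  ascends a a' = toℕ a <ᵇ toℕ a'

  countFrom-ascends : ∀ j (a : Fin k) → countFrom ascends (replicate j true) a ≡ (k ∸ suc (toℕ a)) C j
  countFrom-ascends         zero    a = refl
  countFrom-ascends {k = k} (suc j) a = begin
    countFrom ascends (replicate (suc j) true) a
      ≡⟨ countFrom-∷ ascends true (replicate j true) a ⟩
    ∑[ a' < k ] (if ascends a a' then countFrom ascends (replicate j true) a' else 0)
      ≡⟨ sum-cong-≗ {k} (λ a' → cong (if ascends a a' then_else 0) (countFrom-ascends j a')) ⟩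
    ∑[ a' < k ] (if toℕ a <ᵇ toℕ a' then (k ∸ suc (toℕ a')) C j else 0)
      ≡⟨ hockey-stick-reversed-above k (toℕ a) j ⟩
    (k ∸ suc (toℕ a)) C suc j ∎
    where open ≡-Reasoning

  count-ascends : ∀ k j → count (relatedAt ascends (replicate j true)) (allWords k (suc j)) ≡ k C suc j
  count-ascends k j =
    trans (count-allWords-suc {k} {j} _) (trans (sum-cong-≗ {k} (countFrom-ascends j)) (hockey-stick-reversed k j))

  ascents : Vec (Fin n) (suc j) → Vec Bool j
  ascents (s ∷ [])     = []
  ascents (s ∷ s' ∷ σ) = ⌊ s Fin.<? s' ⌋ ∷ ascents (s' ∷ σ)

  not-≤ᵇ : ∀ m n → not (m ≤ᵇ n) ≡ (n <ᵇ m)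
  not-≤ᵇ zero          n       = refl
  not-≤ᵇ (suc m)       zero    = refl
  not-≤ᵇ (suc zero)    (suc n) = refl
  not-≤ᵇ (suc (suc m)) (suc n) = not-≤ᵇ (suc m) n

  noBadAscent≡relatedAt : ∀ (σ : Vec (Fin n) (suc j)) (w : Vec (Fin k) (suc j)) →
                          noBadAscent σ w ≡ relatedAt descends (ascents σ) w
  noBadAscent≡relatedAt (s ∷ [])     (a ∷ [])     = refl
  noBadAscent≡relatedAt (s ∷ s' ∷ σ) (a ∷ a' ∷ w) =
    cong₂ _∧_ (no-bad-ascent-here ⌊ s Fin.<? s' ⌋) (noBadAscent≡relatedAt (s' ∷ σ) (a' ∷ w))
    where
    no-bad-ascent-here : ∀ b → not (b ∧ ⌊ a Fin.≤? a' ⌋) ≡ (if b then descends a a' else true)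
    no-bad-ascent-here true  = trans (cong not (isYes≗does (a Fin.≤? a'))) (not-≤ᵇ (toℕ a) (toℕ a'))
    no-bad-ascent-here false = refl

  Ar≡sum-descentCount : ∀ n k → Ar (suc n) k ≡ sum (map (descentCount k ∘ ascents) (perms (suc n)))
  Ar≡sum-descentCount n k = begin
    Ar (suc n) k
      ≡⟨ length-filter≡count noBadAscent′ (wreath (suc n) k) ⟩
    count noBadAscent′ (wreath (suc n) k)
      ≡⟨ count-concatMap noBadAscent′ (λ σ → map (σ ,_) (allWords k (suc n))) (perms (suc n)) ⟩
    sum (map (λ σ → count noBadAscent′ (map (σ ,_) (allWords k (suc n)))) (perms (suc n)))
      ≡⟨ cong sum (ListP.map-cong count-fibre (perms (suc n))) ⟩
    sum (map (descentCount k ∘ ascents) (perms (suc n))) ∎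
    where
    open ≡-Reasoning
    noBadAscent′ : Vec (Fin (suc n)) (suc n) × Vec (Fin k) (suc n) → Bool
    noBadAscent′ (σ , w) = noBadAscent σ w
    count-fibre : ∀ σ → count noBadAscent′ (map (σ ,_) (allWords k (suc n))) ≡ descentCount k (ascents σ)
    count-fibre σ = trans (count-map noBadAscent′ (σ ,_) (allWords k (suc n)))
      (trans (count-cong (noBadAscent≡relatedAt σ) (allWords k (suc n))) (count-descends k (ascents σ)))

  allTrue-ascents : ∀ (σ : Vec (Fin n) (suc j)) → allTrue (ascents σ) ≡ relatedAt ascends (replicate j true) σ
  allTrue-ascents (s ∷ [])     = refl
  allTrue-ascents (s ∷ s' ∷ σ) = cong₂ _∧_ (isYes≗does (s Fin.<? s')) (allTrue-ascents (s' ∷ σ))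

  <⇒not-≟ : ∀ (x a : Fin n) → toℕ x ℕ.< toℕ a → T (not ⌊ x Fin.≟ a ⌋)
  <⇒not-≟ x a x<a with x Fin.≟ a
  ... | yes refl = ℕP.<-irrefl refl x<a
  ... | no _     = _

  notIn-increasing : ∀ (x : Fin n) (v : Vec (Fin n) (suc j)) → toℕ x ℕ.< toℕ (Vec.head v) →
                     T (relatedAt ascends (replicate j true) v) → T (notIn x (toList v))
  notIn-increasing x (a ∷ [])     x<a _       = Equivalence.from T-∧ (<⇒not-≟ x a x<a , _)
  notIn-increasing x (a ∷ a' ∷ w) x<a a<a'<w with Equivalence.to T-∧ a<a'<w
  ... | a<a' , a'<w = Equivalence.from T-∧
    (<⇒not-≟ x a x<a , notIn-increasing x (a' ∷ w) (ℕP.<-trans x<a (ℕP.<ᵇ⇒< (toℕ a) (toℕ a') a<a')) a'<w)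

  distinct-increasing : ∀ (v : Vec (Fin n) (suc j)) → T (relatedAt ascends (replicate j true) v) → T (distinct (toList v))
  distinct-increasing (a ∷ [])     _ = _
  distinct-increasing (a ∷ a' ∷ w) a<a'<w with Equivalence.to T-∧ a<a'<w
  ... | a<a' , a'<w = Equivalence.from T-∧
    (notIn-increasing a (a' ∷ w) (ℕP.<ᵇ⇒< (toℕ a) (toℕ a') a<a') a'<w , distinct-increasing (a' ∷ w) a'<w)

  count-allTrue-ascents : ∀ n → count (allTrue ∘ ascents) (perms (suc n)) ≡ 1
  count-allTrue-ascents n = begin
    count (allTrue ∘ ascents) (perms (suc n))
      ≡⟨ count-cong allTrue-ascents (perms (suc n)) ⟩
    count increasing (perms (suc n))
      ≡⟨ count-filter increasing (distinct ∘ toList) distinct-increasing (allWords (suc n) (suc n)) ⟩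
    count increasing (allWords (suc n) (suc n))
      ≡⟨ count-ascends (suc n) n ⟩
    suc n C suc n
      ≡⟨ nCn≡1 (suc n) ⟩
    1 ∎
    where
    open ≡-Reasoning
    increasing = relatedAt ascends (replicate n true)

  sum-multinomial-ascents-positive : ∀ n → 1 ≤ sum (map (multinomial ∘ ascents) (perms (suc n)))
  sum-multinomial-ascents-positive n = ℕP.≤-trans (ℕP.≤-reflexive (sym (count-allTrue-ascents n)))
    (count≤sum (allTrue ∘ ascents) (multinomial ∘ ascents)
               (λ σ all → ℕP.≤-reflexive (sym (multinomial-allTrue (ascents σ) all))) (perms (suc n)))

module Polynomials where

  open import Data.Bool using (Bool; true; false; if_then_else_)
  open import Data.Nat as ℕ using (ℕ; zero; suc; _!)
  import Data.Nat.Properties as ℕP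
  open import Data.Nat.Combinatorics using (_C_; nC1≡n)
  open import Data.Nat.ListAction using (sum)
  open import Data.Integer using (ℤ; +_; -[1+_]; _+_; _*_; -_; _-_; _^_)
  import Data.Integer.Properties as ℤP
  open import Data.Integer.Tactic.RingSolver using (solve-∀)
  open import Data.List as List using (List; []; _∷_; map)
  import Data.List.Properties as ListP
  open import Data.Vec as Vec using (Vec; []; _∷_; head; last; zipWith; replicate)
  open import Function using (_∘_)
  open import Relation.Binary.PropositionalEquality
  open Counting using (leadingTrues; descentCount; multinomial; descentCount-false; descentCount-true;
    multinomial-false; multinomial-true; leadingTrues-allTrue; multinomial-allTrue;
    ascents; allTrue; Ar≡sum-descentCount; count; count-allTrue-ascents; sum-map-*ˡ)

  private
    variable
      A B : Set
      d j : ℕ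

  head-map : ∀ (f : A → B) (v : Vec A (suc d)) → head (Vec.map f v) ≡ f (head v)
  head-map f (a ∷ v) = refl

  last-map : ∀ (f : A → B) (v : Vec A (suc d)) → last (Vec.map f v) ≡ f (last v)
  last-map f (a ∷ [])     = refl
  last-map f (a ∷ b ∷ v) = last-map f (b ∷ v)

  last-zipWith : ∀ {C : Set} (f : A → B → C) (u : Vec A (suc d)) v → last (zipWith f u v) ≡ f (last u) (last v)
  last-zipWith f (a ∷ [])     (b ∷ [])     = refl
  last-zipWith f (a ∷ a' ∷ u) (b ∷ b' ∷ v) = last-zipWith f (a' ∷ u) (b' ∷ v)

  last-replicate : ∀ d (x : A) → last (replicate (suc d) x) ≡ x
  last-replicate zero    x = refl
  last-replicate (suc d) x = last-replicate d x

  eval : Vec ℤ d → ℤ → ℤ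
  eval []       x = + 0
  eval (c ∷ cs) x = c + x * eval cs x

  eval-zipWith : ∀ (u v : Vec ℤ d) x → eval (zipWith _+_ u v) x ≡ eval u x + eval v x
  eval-zipWith []      []      x = refl
  eval-zipWith (a ∷ u) (b ∷ v) x = trans (cong (λ e → a + b + x * e) (eval-zipWith u v x)) (regroup a b x (eval u x) (eval v x))
    where
    regroup : ∀ a b x e f → a + b + x * (e + f) ≡ a + x * e + (b + x * f)
    regroup = solve-∀

  eval-replicate-0 : ∀ d x → eval (replicate d (+ 0)) x ≡ + 0
  eval-replicate-0 zero    x = refl
  eval-replicate-0 (suc d) x = trans (cong (λ e → + 0 + x * e) (eval-replicate-0 d x)) (trans (ℤP.+-identityˡ (x * + 0)) (ℤP.*-zeroʳ x))

  eval-scale : ∀ c (p : Vec ℤ d) x → eval (Vec.map (c *_) p) x ≡ c * eval p x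
  eval-scale c []      x = sym (ℤP.*-zeroʳ c)
  eval-scale c (a ∷ p) x = trans (cong (λ e → c * a + x * e) (eval-scale c p x)) (regroup c a x (eval p x))
    where
    regroup : ∀ c a x e → c * a + x * (c * e) ≡ c * (a + x * e)
    regroup = solve-∀

  addConstant : ℤ → Vec ℤ (suc d) → Vec ℤ (suc d)
  addConstant c (a ∷ p) = c + a ∷ p

  mulXSub : ℤ → Vec ℤ d → Vec ℤ (suc d)
  mulXSub r []      = + 0 ∷ []
  mulXSub r (c ∷ p) = - (r * c) ∷ addConstant c (mulXSub r p)

  eval-addConstant : ∀ c (p : Vec ℤ (suc d)) x → eval (addConstant c p) x ≡ c + eval p x
  eval-addConstant c (a ∷ p) x = ℤP.+-assoc c a (x * eval p x)

  eval-mulXSub : ∀ r (p : Vec ℤ d) x → eval (mulXSub r p) x ≡ (x - r) * eval p x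
  eval-mulXSub r []      x = vanish x r
    where
    vanish : ∀ x r → + 0 + x * + 0 ≡ (x - r) * + 0
    vanish = solve-∀
  eval-mulXSub r (c ∷ p) x = begin
    - (r * c) + x * eval (addConstant c (mulXSub r p)) x ≡⟨ cong (λ e → - (r * c) + x * e) (eval-addConstant c (mulXSub r p) x) ⟩
    - (r * c) + x * (c + eval (mulXSub r p) x)          ≡⟨ cong (λ e → - (r * c) + x * (c + e)) (eval-mulXSub r p x) ⟩
    - (r * c) + x * (c + (x - r) * eval p x)            ≡⟨ expand r c x (eval p x) ⟩
    (x - r) * (c + x * eval p x)                        ∎
    where
    open ≡-Reasoning
    expand : ∀ r c x e → - (r * c) + x * (c + (x - r) * e) ≡ (x - r) * (c + x * e)
    expand = solve-∀

  head-mulXSub : ∀ r (p : Vec ℤ (suc d)) → head (mulXSub r p) ≡ - (r * head p)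
  head-mulXSub r (c ∷ p) = refl

  last-mulXSub : ∀ r (p : Vec ℤ (suc d)) → last (mulXSub r p) ≡ last p
  last-mulXSub r (c ∷ [])     = ℤP.+-identityʳ c
  last-mulXSub r (c ∷ c' ∷ p) = trans (last-addConstant (mulXSub r (c' ∷ p))) (last-mulXSub r (c' ∷ p))
    where
    last-addConstant : ∀ (q : Vec ℤ (suc (suc d))) → last (addConstant c q) ≡ last q
    last-addConstant (a ∷ b ∷ q) = refl

  sumVec : List (Vec ℤ d) → Vec ℤ d
  sumVec {d} = List.foldr (zipWith _+_) (replicate d (+ 0))

  sumℤ : List ℤ → ℤ
  sumℤ = List.foldr _+_ (+ 0)

  sumVec-additive : ∀ (L : Vec ℤ d → ℤ) → (∀ u v → L (zipWith _+_ u v) ≡ L u + L v) → L (replicate d (+ 0)) ≡ + 0 →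
                    ∀ (f : A → Vec ℤ d) xs → L (sumVec (map f xs)) ≡ sumℤ (map (L ∘ f) xs)
  sumVec-additive L L-+ L-0 f []       = L-0
  sumVec-additive L L-+ L-0 f (x ∷ xs) =
    trans (L-+ (f x) (sumVec (map f xs))) (cong (_+_ (L (f x))) (sumVec-additive L L-+ L-0 f xs))

  sumℤ-map-+ : ∀ (f : A → ℕ) xs → sumℤ (map (λ x → + f x) xs) ≡ + sum (map f xs)
  sumℤ-map-+ f []       = refl
  sumℤ-map-+ f (x ∷ xs) = trans (cong (_+_ (+ f x)) (sumℤ-map-+ f xs)) (sym (ℤP.pos-+ (f x) (sum (map f xs))))

  sumℤ-indicator : ∀ (p : A → Bool) c xs → sumℤ (map (λ x → if p x then c else + 0) xs) ≡ + count p xs * c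
  sumℤ-indicator p c []       = refl
  sumℤ-indicator p c (x ∷ xs) with p x
  ... | true  = trans (cong (_+_ c) (sumℤ-indicator p c xs)) (collect c (+ count p xs))
    where
    collect : ∀ c n → c + n * c ≡ (+ 1 + n) * c
    collect = solve-∀
  ... | false = trans (ℤP.+-identityˡ _) (sumℤ-indicator p c xs)

  -- x · eval (blockFalling bs) x is the product of the falling factorials x (x-1) ⋯ (x-L+1)
  -- over the blocks of bs, L the length of the block.
  blockFalling : Vec Bool j → Vec ℤ (suc j)
  blockFalling []           = + 1 ∷ []
  blockFalling (false ∷ bs) = mulXSub (+ 0) (blockFalling bs)
  blockFalling (true ∷ bs)  = mulXSub (+ suc (leadingTrues bs)) (blockFalling bs)

  last-blockFalling : ∀ (bs : Vec Bool j) → last (blockFalling bs) ≡ + 1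
  last-blockFalling []           = refl
  last-blockFalling (false ∷ bs) = trans (last-mulXSub _ (blockFalling bs)) (last-blockFalling bs)
  last-blockFalling (true ∷ bs)  = trans (last-mulXSub _ (blockFalling bs)) (last-blockFalling bs)

  descentCount-polynomial : ∀ k (bs : Vec Bool j) →
    + (suc j !) * + descentCount k bs ≡ + multinomial bs * (+ k * eval (blockFalling bs) (+ k))
  descentCount-polynomial k [] = trans (cong (λ n → + 1 * + n) (trans (ℕP.*-identityʳ (k C 1)) (nC1≡n k))) (simplify (+ k))
    where
    simplify : ∀ x → + 1 * x ≡ + 1 * (x * (+ 1 + x * + 0))
    simplify = solve-∀
  descentCount-polynomial {suc j} k (false ∷ bs) = begin
    + (suc (suc j) !) * + descentCount k (false ∷ bs)
      ≡⟨ cong₂ _*_ (ℤP.pos-* (suc (suc j)) (suc j !)) (trans (cong +_ (descentCount-false k bs)) (ℤP.pos-* k (descentCount k bs))) ⟩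
    (+ (suc (suc j)) * + (suc j !)) * (+ k * + descentCount k bs)
      ≡⟨ regroup (+ (suc (suc j))) (+ (suc j !)) (+ k) (+ descentCount k bs) ⟩
    + (suc (suc j)) * + k * (+ (suc j !) * + descentCount k bs)
      ≡⟨ cong (+ (suc (suc j)) * + k *_) (descentCount-polynomial k bs) ⟩
    + (suc (suc j)) * + k * (+ multinomial bs * (+ k * eval U (+ k)))
      ≡⟨ regroup′ (+ (suc (suc j))) (+ k) (+ multinomial bs) (eval U (+ k)) ⟩
    + (suc (suc j)) * + multinomial bs * (+ k * ((+ k - + 0) * eval U (+ k)))
      ≡⟨ cong₂ (λ m e → m * (+ k * e)) (trans (sym (ℤP.pos-* (suc (suc j)) (multinomial bs))) (cong +_ (sym (multinomial-false bs))))
               (sym (eval-mulXSub (+ 0) U (+ k))) ⟩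
    + multinomial (false ∷ bs) * (+ k * eval (blockFalling (false ∷ bs)) (+ k)) ∎
    where
    open ≡-Reasoning
    U = blockFalling bs
    regroup : ∀ a f x d → (a * f) * (x * d) ≡ a * x * (f * d)
    regroup = solve-∀
    regroup′ : ∀ a x m e → a * x * (m * (x * e)) ≡ a * m * (x * ((x - + 0) * e))
    regroup′ = solve-∀
  descentCount-polynomial {suc j} k (true ∷ bs) = ℤP.*-cancelˡ-≡ t _ _ (begin
    t * (+ (suc (suc j) !) * + D′)
      ≡⟨ cong (λ z → t * (z * + D′)) (ℤP.pos-* (suc (suc j)) (suc j !)) ⟩
    t * (a * f * + D′)
      ≡⟨ regroup₁ t a f (+ D′) ⟩
    a * f * (t * + D′)
      ≡⟨ cong (a * f *_) descent-step ⟩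
    a * f * ((x - σ) * + D)
      ≡⟨ regroup₂ a f (x - σ) (+ D) ⟩
    a * (x - σ) * (f * + D)
      ≡⟨ cong (a * (x - σ) *_) (descentCount-polynomial k bs) ⟩
    a * (x - σ) * (+ M * (x * eval U x))
      ≡⟨ regroup₃ a (x - σ) (+ M) x (eval U x) ⟩
    a * + M * (x * ((x - σ) * eval U x))
      ≡⟨ cong₂ (λ m e → m * (x * e)) (sym multinomial-step) (sym (eval-mulXSub σ U x)) ⟩
    t * + M′ * (x * eval (blockFalling (true ∷ bs)) x)
      ≡⟨ ℤP.*-assoc t (+ M′) _ ⟩
    t * (+ M′ * (x * eval (blockFalling (true ∷ bs)) x)) ∎)
    where
    open ≡-Reasoning
    s = suc (leadingTrues bs)
    t = + suc s
    σ = + s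
    a = + (suc (suc j))
    f = + (suc j !)
    x = + k
    U = blockFalling bs
    D = descentCount k bs
    D′ = descentCount k (true ∷ bs)
    M = multinomial bs
    M′ = multinomial (true ∷ bs)
    descent-step : t * + D′ ≡ (x - σ) * + D
    descent-step = begin
      t * + D′                       ≡⟨ add-sub (t * + D′) (σ * + D) ⟩
      (t * + D′ + σ * + D) - σ * + D ≡⟨ cong (_- σ * + D) cast ⟩
      x * + D - σ * + D              ≡⟨ factor x σ (+ D) ⟩
      (x - σ) * + D                  ∎
      where
      cast : t * + D′ + σ * + D ≡ x * + D
      cast = begin
        t * + D′ + σ * + D             ≡⟨ cong₂ _+_ (ℤP.pos-* (suc s) D′) (ℤP.pos-* s D) ⟨
        + (suc s ℕ.* D′) + + (s ℕ.* D) ≡⟨ ℤP.pos-+ (suc s ℕ.* D′) (s ℕ.* D) ⟨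
        + (suc s ℕ.* D′ ℕ.+ s ℕ.* D)   ≡⟨ cong +_ (descentCount-true k bs) ⟩
        + (k ℕ.* D)                    ≡⟨ ℤP.pos-* k D ⟩
        x * + D                        ∎
      add-sub : ∀ p q → p ≡ (p + q) - q
      add-sub = solve-∀
      factor : ∀ x σ d → x * d - σ * d ≡ (x - σ) * d
      factor = solve-∀
    multinomial-step : t * + M′ ≡ a * + M
    multinomial-step = trans (sym (ℤP.pos-* (suc s) M′)) (trans (cong +_ (multinomial-true bs)) (ℤP.pos-* (suc (suc j)) M))
    regroup₁ : ∀ t a f d → t * (a * f * d) ≡ a * f * (t * d)
    regroup₁ = solve-∀
    regroup₂ : ∀ a f y d → a * f * (y * d) ≡ a * y * (f * d)
    regroup₂ = solve-∀
    regroup₃ : ∀ a y m x e → a * y * (m * (x * e)) ≡ a * m * (x * (y * e))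
    regroup₃ = solve-∀

  signedFactorial : ℕ → ℤ
  signedFactorial j = (-[1+ 0 ] ^ j) * + (j !)

  head-blockFalling : ∀ (bs : Vec Bool j) → head (blockFalling bs) ≡ (if allTrue bs then signedFactorial j else + 0)
  head-blockFalling []           = refl
  head-blockFalling (false ∷ bs) = trans (head-mulXSub (+ 0) (blockFalling bs)) (cong -_ (ℤP.*-zeroˡ (head (blockFalling bs))))
  head-blockFalling {suc j} (true ∷ bs) with allTrue bs in all | head-blockFalling bs
  ... | true  | head≡ = begin
    head (mulXSub (+ suc l) (blockFalling bs))
      ≡⟨ head-mulXSub (+ suc l) (blockFalling bs) ⟩
    - (+ suc l * head (blockFalling bs))
      ≡⟨ cong₂ (λ l h → - (+ suc l * h)) (leadingTrues-allTrue bs all) head≡ ⟩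
    - (+ suc j * signedFactorial j)
      ≡⟨ regroup (+ suc j) (-[1+ 0 ] ^ j) (+ (j !)) ⟩
    -[1+ 0 ] * (-[1+ 0 ] ^ j) * (+ suc j * + (j !))
      ≡⟨ cong (-[1+ 0 ] * (-[1+ 0 ] ^ j) *_) (ℤP.pos-* (suc j) (j !)) ⟨
    signedFactorial (suc j) ∎
    where
    open ≡-Reasoning
    l = leadingTrues bs
    regroup : ∀ a b c → - (a * (b * c)) ≡ -[1+ 0 ] * b * (a * c)
    regroup = solve-∀
  ... | false | head≡ = trans (head-mulXSub (+ suc l) (blockFalling bs)) (cong -_ (trans (cong (+ suc l *_) head≡) (ℤP.*-zeroʳ (+ suc l))))
    where l = leadingTrues bs

  blockPolynomial : Vec Bool j → Vec ℤ (suc j)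
  blockPolynomial bs = Vec.map (+ multinomial bs *_) (blockFalling bs)

  eval-blockPolynomial : ∀ k (bs : Vec Bool j) → + k * eval (blockPolynomial bs) (+ k) ≡ + (suc j ! ℕ.* descentCount k bs)
  eval-blockPolynomial {j} k bs = begin
    + k * eval (Vec.map (+ M *_) (blockFalling bs)) (+ k) ≡⟨ cong (+ k *_) (eval-scale (+ M) (blockFalling bs) (+ k)) ⟩
    + k * (+ M * eval (blockFalling bs) (+ k))          ≡⟨ swap (+ k) (+ M) (eval (blockFalling bs) (+ k)) ⟩
    + M * (+ k * eval (blockFalling bs) (+ k))          ≡⟨ descentCount-polynomial k bs ⟨
    + (suc j !) * + descentCount k bs                   ≡⟨ ℤP.pos-* (suc j !) (descentCount k bs) ⟨
    + (suc j ! ℕ.* descentCount k bs)                   ∎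
    where
    open ≡-Reasoning
    M = multinomial bs
    swap : ∀ x m e → x * (m * e) ≡ m * (x * e)
    swap = solve-∀

  head-blockPolynomial : ∀ (bs : Vec Bool j) → head (blockPolynomial bs) ≡ (if allTrue bs then signedFactorial j else + 0)
  head-blockPolynomial bs with allTrue bs in all | blockFalling bs | head-blockFalling bs
  ... | true  | c ∷ _ | refl = trans (cong (λ m → + m * c) (multinomial-allTrue bs all)) (ℤP.*-identityˡ c)
  ... | false | c ∷ _ | refl = ℤP.*-zeroʳ (+ multinomial bs)

  last-blockPolynomial : ∀ (bs : Vec Bool j) → last (blockPolynomial bs) ≡ + multinomial bs
  last-blockPolynomial bs =
    trans (last-map (+ multinomial bs *_) (blockFalling bs))
          (trans (cong (+ multinomial bs *_) (last-blockFalling bs)) (ℤP.*-identityʳ (+ multinomial bs)))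

  coefficients : ∀ m → Vec ℤ (suc m)
  coefficients m = sumVec (map (blockPolynomial ∘ ascents) (perms (suc m)))

  eval-coefficients : ∀ m k → + k * eval (coefficients m) (+ k) ≡ + (suc m ! ℕ.* Ar (suc m) k)
  eval-coefficients m k = begin
    + k * eval (coefficients m) (+ k)
      ≡⟨ sumVec-additive (λ p → + k * eval p (+ k)) L-+ L-0 (blockPolynomial ∘ ascents) (perms (suc m)) ⟩
    sumℤ (map (λ σ → + k * eval (blockPolynomial (ascents σ)) (+ k)) (perms (suc m)))
      ≡⟨ cong sumℤ (ListP.map-cong (eval-blockPolynomial k ∘ ascents) (perms (suc m))) ⟩
    sumℤ (map (λ σ → + (suc m ! ℕ.* descentCount k (ascents σ))) (perms (suc m)))
      ≡⟨ sumℤ-map-+ (λ σ → suc m ! ℕ.* descentCount k (ascents σ)) (perms (suc m)) ⟩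
    + sum (map (λ σ → suc m ! ℕ.* descentCount k (ascents σ)) (perms (suc m)))
      ≡⟨ cong +_ (sum-map-*ˡ (descentCount k ∘ ascents) (suc m !) (perms (suc m))) ⟩
    + (suc m ! ℕ.* sum (map (descentCount k ∘ ascents) (perms (suc m))))
      ≡⟨ cong (λ n → + (suc m ! ℕ.* n)) (Ar≡sum-descentCount m k) ⟨
    + (suc m ! ℕ.* Ar (suc m) k) ∎
    where
    open ≡-Reasoning
    L-+ : ∀ u v → + k * eval (zipWith _+_ u v) (+ k) ≡ + k * eval u (+ k) + + k * eval v (+ k)
    L-+ u v = trans (cong (+ k *_) (eval-zipWith u v (+ k))) (ℤP.*-distribˡ-+ (+ k) (eval u (+ k)) (eval v (+ k)))
    L-0 : + k * eval (replicate (suc m) (+ 0)) (+ k) ≡ + 0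
    L-0 = trans (cong (+ k *_) (eval-replicate-0 (suc m) (+ k))) (ℤP.*-zeroʳ (+ k))

  head-coefficients : ∀ m → head (coefficients m) ≡ signedFactorial m
  head-coefficients m = begin
    head (coefficients m)
      ≡⟨ sumVec-additive head head-+ refl (blockPolynomial ∘ ascents) (perms (suc m)) ⟩
    sumℤ (map (head ∘ blockPolynomial ∘ ascents) (perms (suc m)))
      ≡⟨ cong sumℤ (ListP.map-cong (head-blockPolynomial ∘ ascents) (perms (suc m))) ⟩
    sumℤ (map (λ σ → if allTrue (ascents σ) then signedFactorial m else + 0) (perms (suc m)))
      ≡⟨ sumℤ-indicator (allTrue ∘ ascents) (signedFactorial m) (perms (suc m)) ⟩
    + count (allTrue ∘ ascents) (perms (suc m)) * signedFactorial m
      ≡⟨ cong (λ n → + n * signedFactorial m) (count-allTrue-ascents m) ⟩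
    + 1 * signedFactorial m
      ≡⟨ ℤP.*-identityˡ (signedFactorial m) ⟩
    signedFactorial m ∎
    where
    open ≡-Reasoning
    head-+ : ∀ (u v : Vec ℤ (suc m)) → head (zipWith _+_ u v) ≡ head u + head v
    head-+ (a ∷ u) (b ∷ v) = refl

  last-coefficients : ∀ m → last (coefficients m) ≡ + sum (map (multinomial ∘ ascents) (perms (suc m)))
  last-coefficients m = begin
    last (coefficients m)
      ≡⟨ sumVec-additive last (last-zipWith _+_) (last-replicate m (+ 0)) (blockPolynomial ∘ ascents) (perms (suc m)) ⟩
    sumℤ (map (last ∘ blockPolynomial ∘ ascents) (perms (suc m)))
      ≡⟨ cong sumℤ (ListP.map-cong (last-blockPolynomial ∘ ascents) (perms (suc m))) ⟩
    sumℤ (map (λ σ → + multinomial (ascents σ)) (perms (suc m)))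
      ≡⟨ sumℤ-map-+ (multinomial ∘ ascents) (perms (suc m)) ⟩
    + sum (map (multinomial ∘ ascents) (perms (suc m))) ∎
    where open ≡-Reasoning

module Rationals where

  open import Data.Nat as ℕ using (ℕ; suc)
  open import Data.Integer as ℤ using (ℤ; +_)
  import Data.Integer.Properties as ℤP
  open import Data.Integer.Tactic.RingSolver using (solve-∀)
  open import Data.Rational using (ℚ; _/_; _+_; _*_; 0ℚ; toℚᵘ)
  open import Data.Rational.Properties using (toℚᵘ-injective; toℚᵘ-fromℚᵘ; toℚᵘ-homo-+; toℚᵘ-homo-*)
  open import Data.Rational.Unnormalised as ℚᵘ using (mkℚᵘ; *≡*; _≃_)
  import Data.Rational.Unnormalised.Properties as ℚᵘP
  open import Data.Vec as Vec using (Vec; []; _∷_)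
  open import Relation.Binary.PropositionalEquality
  open Polynomials using (eval)

  toℚ : ℤ → ℚ
  toℚ i = i / 1

  toℚᵘ-toℚ : ∀ i → toℚᵘ (toℚ i) ≃ mkℚᵘ i 0
  toℚᵘ-toℚ i = toℚᵘ-fromℚᵘ (mkℚᵘ i 0)

  toℚ-+ : ∀ i j → toℚ (i ℤ.+ j) ≡ toℚ i + toℚ j
  toℚ-+ i j = toℚᵘ-injective (begin
    toℚᵘ (toℚ (i ℤ.+ j))               ≈⟨ toℚᵘ-toℚ (i ℤ.+ j) ⟩
    mkℚᵘ (i ℤ.+ j) 0                   ≈⟨ *≡* (over-1 i j) ⟩
    mkℚᵘ i 0 ℚᵘ.+ mkℚᵘ j 0             ≈⟨ ℚᵘP.+-cong (toℚᵘ-toℚ i) (toℚᵘ-toℚ j) ⟨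
    toℚᵘ (toℚ i) ℚᵘ.+ toℚᵘ (toℚ j)     ≈⟨ toℚᵘ-homo-+ (toℚ i) (toℚ j) ⟨
    toℚᵘ (toℚ i + toℚ j)               ∎)
    where
    open ℚᵘP.≃-Reasoning
    over-1 : ∀ i j → (i ℤ.+ j) ℤ.* + 1 ≡ (i ℤ.* + 1 ℤ.+ j ℤ.* + 1) ℤ.* + 1
    over-1 = solve-∀

  toℚ-* : ∀ i j → toℚ (i ℤ.* j) ≡ toℚ i * toℚ j
  toℚ-* i j = toℚᵘ-injective (begin
    toℚᵘ (toℚ (i ℤ.* j))               ≈⟨ toℚᵘ-toℚ (i ℤ.* j) ⟩
    mkℚᵘ (i ℤ.* j) 0                   ≈⟨ ℚᵘP.≃-refl ⟩
    mkℚᵘ i 0 ℚᵘ.* mkℚᵘ j 0             ≈⟨ ℚᵘP.*-cong (toℚᵘ-toℚ i) (toℚᵘ-toℚ j) ⟨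
    toℚᵘ (toℚ i) ℚᵘ.* toℚᵘ (toℚ j)     ≈⟨ toℚᵘ-homo-* (toℚ i) (toℚ j) ⟨
    toℚᵘ (toℚ i * toℚ j)               ∎)
    where open ℚᵘP.≃-Reasoning

  toℚ-injective : ∀ {i j} → toℚ i ≡ toℚ j → i ≡ j
  toℚ-injective {i} {j} eq with ℚᵘP.≃-trans (ℚᵘP.≃-sym (toℚᵘ-toℚ i)) (ℚᵘP.≃-trans (ℚᵘP.≃-reflexive (cong toℚᵘ eq)) (toℚᵘ-toℚ j))
  ... | *≡* i*1≡j*1 = trans (sym (ℤP.*-identityʳ i)) (trans i*1≡j*1 (ℤP.*-identityʳ j))

  toℚ-pos≢0 : ∀ {n} → 1 ℕ.≤ n → toℚ (+ n) ≢ 0ℚ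
  toℚ-pos≢0 {suc n} (ℕ.s≤s _) eq with toℚ-injective {+ suc n} {+ 0} eq
  ... | ()

  1/n*toℚ-n* : ∀ n .{{_ : ℕ.NonZero n}} i → (+ 1 / n) * toℚ (+ n ℤ.* i) ≡ toℚ i
  1/n*toℚ-n* (suc n) i = toℚᵘ-injective (begin
    toℚᵘ ((+ 1 / suc n) * toℚ (+ suc n ℤ.* i))        ≈⟨ toℚᵘ-homo-* (+ 1 / suc n) (toℚ (+ suc n ℤ.* i)) ⟩
    toℚᵘ (+ 1 / suc n) ℚᵘ.* toℚᵘ (toℚ (+ suc n ℤ.* i)) ≈⟨ ℚᵘP.*-cong (toℚᵘ-fromℚᵘ (mkℚᵘ (+ 1) n)) (toℚᵘ-toℚ (+ suc n ℤ.* i)) ⟩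
    mkℚᵘ (+ 1) n ℚᵘ.* mkℚᵘ (+ suc n ℤ.* i) 0          ≈⟨ *≡* (cancel (+ suc n) i) ⟩
    mkℚᵘ i 0                                          ≈⟨ toℚᵘ-toℚ i ⟨
    toℚᵘ (toℚ i)                                      ∎)
    where
    open ℚᵘP.≃-Reasoning
    cancel : ∀ m i → (+ 1 ℤ.* (m ℤ.* i)) ℤ.* + 1 ≡ i ℤ.* (m ℤ.* + 1)
    cancel = solve-∀

  evalPoly-map-toℚ : ∀ {d} (p : Vec ℤ d) x → evalPoly (Vec.map toℚ p) (toℚ x) ≡ toℚ (eval p x)
  evalPoly-map-toℚ []      x = refl
  evalPoly-map-toℚ (c ∷ p) x = begin
    toℚ c + toℚ x * evalPoly (Vec.map toℚ p) (toℚ x) ≡⟨ cong (λ e → toℚ c + toℚ x * e) (evalPoly-map-toℚ p x) ⟩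
    toℚ c + toℚ x * toℚ (eval p x)                   ≡⟨ cong (_+_ (toℚ c)) (toℚ-* x (eval p x)) ⟨
    toℚ c + toℚ (x ℤ.* eval p x)                     ≡⟨ toℚ-+ c (x ℤ.* eval p x) ⟨
    toℚ (c ℤ.+ x ℤ.* eval p x)                       ∎
    where open ≡-Reasoning

open import Data.Nat using (ℕ; suc; _≤_; _!)
open import Data.Nat.Properties using (_!≢0)
open import Data.Vec using (Vec; last; head)
open import Data.Integer using (ℤ; +_; -[1+_]; _^_) renaming (_*_ to _*ℤ_)
open import Data.Rational using (ℚ; _/_; _*_; 0ℚ)
open import Data.Product using (Σ; _×_; _,_)
open import Relation.Binary.PropositionalEquality using (_≡_; _≢_; sym; trans; cong; module ≡-Reasoning)
import Data.Integer.Properties as ℤP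
import Data.Vec as Vec
open Counting using (sum-multinomial-ascents-positive)
open Polynomials using (eval; coefficients; eval-coefficients; head-coefficients; last-coefficients; head-map; last-map)
open Rationals using (toℚ; toℚ-*; toℚ-pos≢0; 1/n*toℚ-n*; evalPoly-map-toℚ)

Ar≡evalPoly : ∀ m k → ℕ→ℚ (Ar (suc m) k) ≡
  (_/_ (+ 1) (suc m !) {{suc m !≢0}}) * (ℕ→ℚ k * evalPoly (Vec.map toℚ (coefficients m)) (ℕ→ℚ k))
Ar≡evalPoly m k = sym (begin
  1/n! * (toℚ (+ k) * evalPoly (Vec.map toℚ P) (toℚ (+ k)))
    ≡⟨ cong (λ e → 1/n! * (toℚ (+ k) * e)) (evalPoly-map-toℚ P (+ k)) ⟩
  1/n! * (toℚ (+ k) * toℚ (eval P (+ k)))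
    ≡⟨ cong (1/n! *_) (toℚ-* (+ k) (eval P (+ k))) ⟨
  1/n! * toℚ (+ k *ℤ eval P (+ k))
    ≡⟨ cong (λ i → 1/n! * toℚ i) (trans (eval-coefficients m k) (ℤP.pos-* (suc m !) (Ar (suc m) k))) ⟩
  1/n! * toℚ (+ (suc m !) *ℤ + Ar (suc m) k)
    ≡⟨ 1/n*toℚ-n* (suc m !) {{suc m !≢0}} (+ Ar (suc m) k) ⟩
  toℚ (+ Ar (suc m) k) ∎)
  where
  open ≡-Reasoning
  P = coefficients m
  1/n! = _/_ (+ 1) (suc m !) {{suc m !≢0}}

mainTheorem15 : (m : ℕ) → Σ (Vec ℚ (suc m)) (λ P →
    (last P ≢ 0ℚ)
    × ((k : ℕ) → 2 ≤ k →
        ℕ→ℚ (Ar (suc m) k) ≡ (_/_ (+ 1) (suc m !) {{suc m !≢0}}) * (ℕ→ℚ k * evalPoly P (ℕ→ℚ k)))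
    × (head P ≡ (-[1+ 0 ] ^ m) *ℤ (+ (m !)) / 1))
mainTheorem15 m = Vec.map toℚ (coefficients m) , leading≢0 , (λ k _ → Ar≡evalPoly m k) , constant-term
  -- The identity holds for every k.
  where
  leading≢0 : last (Vec.map toℚ (coefficients m)) ≢ 0ℚ
  leading≢0 eq = toℚ-pos≢0 (sum-multinomial-ascents-positive m)
    (trans (sym (trans (last-map toℚ (coefficients m)) (cong toℚ (last-coefficients m)))) eq)
  constant-term : head (Vec.map toℚ (coefficients m)) ≡ (-[1+ 0 ] ^ m) *ℤ (+ (m !)) / 1
  constant-term = trans (head-map toℚ (coefficients m)) (cong toℚ (head-coefficients m))
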